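{- Let $\Gamma$ be a Harrop cedent with $\bot\notin\Gamma$, and let $\alpha$ be a non-Harrop formula (i.e. $\alpha$ contains a strictly positive occurrence of a disjunction). Then every Harrop normal $\mathsf{NJp}$-derivation of $\Gamma\Rightarrow\alpha$ ends with an introduction rule.
   Context: Formulas are propositional formulas built from atoms and $\bot$ with $\lor,\land,\supset$; a cedent is a finite set of formulas and a sequent $\Gamma\Rightarrow\alpha$ pairs a cedent with a formula. $\mathsf{NJp}$ has axioms $\alpha,\Gamma\Rightarrow\alpha$ and $\bot,\Gamma\Rightarrow p$ ($p$ atom) and rules $(\lor E)$: from $\Gamma\Rightarrow\alpha_0\lor\alpha_1$, $\alpha_0,\Gamma\Rightarrow\beta$, $\alpha_1,\Gamma\Rightarrow\beta$ infer $\Gamma\Rightarrow\beta$; $(\lor I)$: from $\Gamma\Rightarrow\alpha_i$ infer $\Gamma\Rightarrow\alpha_0\lor\alpha_1$; $(\land E)$: from $\Gamma\Rightarrow\alpha_0\land\alpha_1$ infer $\Gamma\Rightarrow\alpha_i$; $(\land I)$: from $\Gamma\Rightarrow\alpha_0$, $\Gamma\Rightarrow\alpha_1$ infer $\Gamma\Rightarrow\alpha_0\land\alpha_1$; $(\supset E)$: from $\Gamma\Rightarrow\alpha\supset\beta$, $\Gamma\Rightarrow\alpha$ infer $\Gamma\Rightarrow\beta$; $(\supset I)$: from $\alpha,\Gamma\Rightarrow\beta$ infer $\Gamma\Rightarrow\alpha\supset\beta$. $(I)$-rules are introduction rules; $(E)$-rules are elimination rules, whose major premiss is the first listed premiss.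 An occurrence of a subformula is strictly positive in $\alpha$ if it is $\alpha$ itself, or $\alpha$ is $\alpha_0\lor\alpha_1$ or $\alpha_0\land\alpha_1$ and it is strictly positive in some $\alpha_i$, or $\alpha$ is $\alpha_0\supset\alpha_1$ and it is strictly positive in $\alpha_1$. A Harrop formula has no strictly positive occurrence of a disjunction; a Harrop cedent consists of Harrop formulas. A formula occurrence in a derivation is Harrop maximal if it is the conclusion of an introduction rule and simultaneously the major premiss of an elimination rule whose conclusion has a Harrop antecedent. A derivation is Harrop normal if it contains no Harrop maximal formula occurrence. -}

module Defs where

open import Data.Nat using (ℕ)
open import Data.List using (List; _∷_)
open import Data.List.Membership.Propositional using (_∈_)
open import Data.List.Relation.Unary.All using (All)
open import Data.Product using (Σ; _×_)
open import Data.Empty using (⊥)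
open import Data.Unit using (⊤)
open import Relation.Nullary using (¬_)

data Fm : Set where
  atom : ℕ → Fm
  ⊥'   : Fm
  _∨'_ : Fm → Fm → Fm
  _∧'_ : Fm → Fm → Fm
  _⊃_  : Fm → Fm → Fm

infixr 6 _∧'_
infixr 5 _∨'_
infixr 4 _⊃_

-- Cedents: finite sets of formulas, represented by lists
-- (only membership matters in all definitions below).
Cedent : Set
Cedent = List Fm

data StrPos (β : Fm) : Fm → Set where
  here  : StrPos β β
  ∨l    : ∀ {a b} → StrPos β a → StrPos β (a ∨' b)
  ∨r    : ∀ {a b} → StrPos β b → StrPos β (a ∨' b)
  ∧l    : ∀ {a b} → StrPos β a → StrPos β (a ∧' b)
  ∧r    : ∀ {a b} → StrPos β b → StrPos β (a ∧' b)
  ⊃r    : ∀ {a b} → StrPos β b → StrPos β (a ⊃ b)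

Harrop : Fm → Set
Harrop α = ¬ (Σ Fm λ β → Σ Fm λ γ → StrPos (β ∨' γ) α)

HarropCedent : Cedent → Set
HarropCedent Γ = All Harrop Γ

data NJp : Cedent → Fm → Set where
  ax   : ∀ {Γ α} → α ∈ Γ → NJp Γ α
  ax⊥  : ∀ {Γ p} → ⊥' ∈ Γ → NJp Γ (atom p)
  ∨E   : ∀ {Γ a₀ a₁ β} → NJp Γ (a₀ ∨' a₁) → NJp (a₀ ∷ Γ) β → NJp (a₁ ∷ Γ) β → NJp Γ β
  ∨I₀  : ∀ {Γ a₀ a₁} → NJp Γ a₀ → NJp Γ (a₀ ∨' a₁)
  ∨I₁  : ∀ {Γ a₀ a₁} → NJp Γ a₁ → NJp Γ (a₀ ∨' a₁)
  ∧E₀  : ∀ {Γ a₀ a₁} → NJp Γ (a₀ ∧' a₁) → NJp Γ a₀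
  ∧E₁  : ∀ {Γ a₀ a₁} → NJp Γ (a₀ ∧' a₁) → NJp Γ a₁
  ∧I   : ∀ {Γ a₀ a₁} → NJp Γ a₀ → NJp Γ a₁ → NJp Γ (a₀ ∧' a₁)
  ⊃E   : ∀ {Γ a b} → NJp Γ (a ⊃ b) → NJp Γ a → NJp Γ b
  ⊃I   : ∀ {Γ a b} → NJp (a ∷ Γ) b → NJp Γ (a ⊃ b)

EndsWithIntro : ∀ {Γ α} → NJp Γ α → Set
EndsWithIntro (ax _) = ⊥
EndsWithIntro (ax⊥ _) = ⊥
EndsWithIntro (∨E _ _ _) = ⊥
EndsWithIntro (∨I₀ _) = ⊤
EndsWithIntro (∨I₁ _) = ⊤
EndsWithIntro (∧E₀ _) = ⊥
EndsWithIntro (∧E₁ _) = ⊥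
EndsWithIntro (∧I _ _) = ⊤
EndsWithIntro (⊃E _ _) = ⊥
EndsWithIntro (⊃I _) = ⊤

-- the major premiss of an elimination with conclusion Γ ⇒ _ (derived by d)
-- is not Harrop maximal
NotHMax : ∀ {Γ α} → NJp Γ α → Set
NotHMax {Γ} d = HarropCedent Γ → ¬ EndsWithIntro d

HarropNormal : ∀ {Γ α} → NJp Γ α → Set
HarropNormal (ax _) = ⊤
HarropNormal (ax⊥ _) = ⊤
HarropNormal (∨E d e f) = NotHMax d × HarropNormal d × HarropNormal e × HarropNormal f
HarropNormal (∨I₀ d) = HarropNormal d
HarropNormal (∨I₁ d) = HarropNormal d
HarropNormal (∧E₀ d) = NotHMax d × HarropNormal d
HarropNormal (∧E₁ d) = NotHMax d × HarropNormal d
HarropNormal (∧I d e) = HarropNormal d × HarropNormal e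
HarropNormal (⊃E d e) = NotHMax d × HarropNormal d × HarropNormal e
HarropNormal (⊃I d) = HarropNormal d

-- The key observation is that strictly positive subformulas of a Harrop
-- formula are again Harrop (strict positivity is transitive).  Now follow a
-- derivation that does not end with an introduction rule upwards along its
-- major premisses.  Harrop normality says that each major premiss, whose
-- antecedent is the Harrop cedent Γ, again does not end with an introduction
-- rule, so by induction it has a Harrop conclusion.  Its conclusion α₀ ∧ α₁ or
-- α ⊃ β then yields a Harrop conclusion for the elimination, while a Harrop
-- major premiss α₀ ∨ α₁ of (∨E) is impossible.  The branch ends in an axiom:
-- ⊥-axioms are excluded by ⊥ ∉ Γ, and identity axioms conclude a member of Γ.
-- Hence every such derivation concludes a Harrop formula, and the theorem
-- follows by contraposition.
module Submission where

open import Defs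
open import Data.List.Membership.Propositional using (_∉_)
open import Data.List.Relation.Unary.All using (lookup)
open import Data.Product using (_,_)
open import Data.Unit using (tt)
open import Data.Empty using (⊥-elim)
open import Relation.Nullary using (¬_; Dec; yes; no; contradiction)

strPos-trans : ∀ {α β γ} → StrPos α β → StrPos β γ → StrPos α γ
strPos-trans p here   = p
strPos-trans p (∨l q) = ∨l (strPos-trans p q)
strPos-trans p (∨r q) = ∨r (strPos-trans p q)
strPos-trans p (∧l q) = ∧l (strPos-trans p q)
strPos-trans p (∧r q) = ∧r (strPos-trans p q)
strPos-trans p (⊃r q) = ⊃r (strPos-trans p q)

harrop-strPos : ∀ {α β} → StrPos β α → Harrop α → Harrop β
harrop-strPos p hα (γ , δ , q) = hα (γ , δ , strPos-trans q p)

disjunction-not-Harrop : ∀ {α β} → ¬ Harrop (α ∨' β)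
disjunction-not-Harrop h = h (_ , _ , here)

-- Harrop normality turns "not an introduction" into the same property of the
-- major premiss, which makes the induction along major premisses go through.
nonIntro-conclusion-Harrop : ∀ {Γ α} → HarropCedent Γ → ⊥' ∉ Γ →
  (d : NJp Γ α) → HarropNormal d → ¬ EndsWithIntro d → Harrop α
nonIntro-conclusion-Harrop hΓ ⊥∉Γ (ax α∈Γ) _ _ = lookup hΓ α∈Γ
nonIntro-conclusion-Harrop hΓ ⊥∉Γ (ax⊥ ⊥∈Γ) _ _ = contradiction ⊥∈Γ ⊥∉Γ
nonIntro-conclusion-Harrop hΓ ⊥∉Γ (∨E d _ _) (notMax , hd , _) _ =
  ⊥-elim (disjunction-not-Harrop
    (nonIntro-conclusion-Harrop hΓ ⊥∉Γ d hd (notMax hΓ)))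
nonIntro-conclusion-Harrop hΓ ⊥∉Γ (∧E₀ d) (notMax , hd) _ =
  harrop-strPos (∧l here) (nonIntro-conclusion-Harrop hΓ ⊥∉Γ d hd (notMax hΓ))
nonIntro-conclusion-Harrop hΓ ⊥∉Γ (∧E₁ d) (notMax , hd) _ =
  harrop-strPos (∧r here) (nonIntro-conclusion-Harrop hΓ ⊥∉Γ d hd (notMax hΓ))
nonIntro-conclusion-Harrop hΓ ⊥∉Γ (⊃E d _) (notMax , hd , _) _ =
  harrop-strPos (⊃r here) (nonIntro-conclusion-Harrop hΓ ⊥∉Γ d hd (notMax hΓ))
nonIntro-conclusion-Harrop _ _ (∨I₀ _) _ notIntro = contradiction tt notIntro
nonIntro-conclusion-Harrop _ _ (∨I₁ _) _ notIntro = contradiction tt notIntro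
nonIntro-conclusion-Harrop _ _ (∧I _ _) _ notIntro = contradiction tt notIntro
nonIntro-conclusion-Harrop _ _ (⊃I _) _ notIntro = contradiction tt notIntro

endsWithIntro? : ∀ {Γ α} (d : NJp Γ α) → Dec (EndsWithIntro d)
endsWithIntro? (ax _)     = no λ ()
endsWithIntro? (ax⊥ _)    = no λ ()
endsWithIntro? (∨E _ _ _) = no λ ()
endsWithIntro? (∨I₀ _)    = yes tt
endsWithIntro? (∨I₁ _)    = yes tt
endsWithIntro? (∧E₀ _)    = no λ ()
endsWithIntro? (∧E₁ _)    = no λ ()
endsWithIntro? (∧I _ _)   = yes tt
endsWithIntro? (⊃E _ _)   = no λ ()
endsWithIntro? (⊃I _)     = yes tt

-- If d did not end with an introduction rule, the main lemma would make the
-- non-Harrop formula α Harrop.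
proposition3p5 : (Γ : Cedent) (α : Fm) → HarropCedent Γ → ⊥' ∉ Γ → ¬ Harrop α →
    (d : NJp Γ α) → HarropNormal d → EndsWithIntro d
proposition3p5 _ _ hΓ ⊥∉Γ notHarrop d hd with endsWithIntro? d
... | yes intro   = intro
... | no notIntro =
  contradiction (nonIntro-conclusion-Harrop hΓ ⊥∉Γ d hd notIntro) notHarrop
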